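{- Let $(t_n)_{n\ge 0}$ be a non-trivial subprime Fibonacci sequence. Then there exists $N$ such that $\gcd(t_n,t_{n+1})=1$ for all $n\ge N$.
   Context: A subprime Fibonacci sequence is a sequence $(t_n)_{n\ge0}$ of positive integers in which $t_0,t_1$ are arbitrary positive integers and, for every $n\ge0$, with $s=t_n+t_{n+1}$: $t_{n+2}=s$ if $s$ is prime, and $t_{n+2}=s/p$ if $s$ is composite, where $p$ is the smallest prime factor of $s$. Such a sequence is called trivial if it is eventually constant, and non-trivial otherwise. -}

module Defs where

open import Data.Nat using (ℕ; suc; _+_; _*_; _≤_; _<_)
open import Data.Nat.Divisibility using (_∣_)
open import Data.Nat.Primality using (Prime)
open import Data.Product using (Σ; _×_; ∃)
open import Relation.Binary.PropositionalEquality using (_≡_; _≢_)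
open import Relation.Nullary using (¬_)

SmallestPrimeFactor : ℕ → ℕ → Set
SmallestPrimeFactor p s = Prime p × p ∣ s × (∀ q → Prime q → q ∣ s → p ≤ q)

-- one step of the recurrence: u = next term given s = t_n + t_{n+1}
-- (s ≥ 2 automatically since all terms are positive; composite = not prime)
SubprimeStep : ℕ → ℕ → Set
SubprimeStep s u =
  (Prime s → u ≡ s) ×
  (¬ Prime s → ∀ p → SmallestPrimeFactor p s → p * u ≡ s)

IsSubprimeFib : (ℕ → ℕ) → Set
IsSubprimeFib t = (∀ n → 0 < t n) × (∀ n → SubprimeStep (t n + t (suc n)) (t (suc (suc n))))

Trivial : (ℕ → ℕ) → Set
Trivial t = ∃ λ N → ∀ n → N ≤ n → t n ≡ t N

{-# OPTIONS --safe #-}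
module Submission where

open import Defs
open import Data.Nat using (ℕ; suc; _≤_)
open import Data.Nat.GCD using (gcd)
open import Data.Product using (∃)
open import Relation.Binary.PropositionalEquality using (_≡_)
open import Relation.Nullary using (¬_)

open import Data.Empty using (⊥-elim)
open import Data.Nat.Base
  using ( zero; _+_; _*_; _∸_; _<_; _⊔_; _≤′_; ≤′-refl; ≤′-step; z<s
        ; NonTrivial; >-nonZero; n>1⇒nonTrivial; nonTrivial⇒n>1)
open import Data.Nat.Properties
open import Data.Nat.Divisibility
  using (_∣_; _∣?_; divides; ∣-refl; ∣-trans; ∣⇒≤; ∣1⇒≡1; ∣m∣n⇒∣m+n; ∣m+n∣m⇒∣n)
open import Data.Nat.Divisibility.Core using (hasNonTrivialDivisor)
open import Data.Nat.GCD using (gcd[m,n]∣m; gcd[m,n]∣n; gcd-greatest; gcd[m,n]≢0)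
open import Data.Nat.Primality
  using (Prime; _Rough_; prime?; prime[2]; prime⇒nonTrivial; rough∧∣⇒prime; ∤⇒rough-suc; 2-rough)
open import Data.Product using (_,_; _×_; proj₁; proj₂)
open import Data.Sum using (inj₁)
open import Function using (_∘_)
open import Relation.Binary.Definitions using (tri<; tri≈; tri>)
open import Relation.Binary.PropositionalEquality using (refl; sym; trans; cong; subst; _≢_)
open import Relation.Nullary using (yes; no)

-- Since t (n+2) divides t n + t (n+1), every divisor of gcd (t (n+1)) (t (n+2))
-- divides gcd (t n) (t (n+1)): the consecutive gcds form a divisibility chain, so
-- once one of them is 1 all later ones are. While gcd (t n) (t (n+1)) ≥ 2, the sum
-- t n + t (n+1) is composite, so t (n+2) is at most half of it. Two such steps in a
-- row strictly lower max (t n) (t (n+1)) unless t n = t (n+1); in that case both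
-- terms equal the gcd, which is ≥ 2, and the sequence is constant from there on.
-- A non-trivial sequence therefore reaches a coprime pair after finitely many steps.

m+m≡2*m : ∀ m → m + m ≡ 2 * m
m+m≡2*m m = cong (m +_) (sym (+-identityʳ m))

m+m<n+n⇒m<n : ∀ {m n} → m + m < n + n → m < n
m+m<n+n⇒m<n {m} {n} lt = ≰⇒> (λ n≤m → <⇒≱ lt (+-mono-≤ n≤m n≤m))

m≢n⇒m+n<[m⊔n]+[m⊔n] : ∀ {m n} → m ≢ n → m + n < (m ⊔ n) + (m ⊔ n)
m≢n⇒m+n<[m⊔n]+[m⊔n] {m} {n} m≢n with <-cmp m n
... | tri< m<n _ _ = +-mono-<-≤ (<-≤-trans m<n (m≤n⊔m m n)) (m≤n⊔m m n)
... | tri≈ _ m≡n _ = ⊥-elim (m≢n m≡n)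
... | tri> _ _ m>n = +-mono-≤-< (m≤m⊔n m n) (<-≤-trans m>n (m≤m⊔n m n))

⊔-decreases-by-halving : ∀ {a b c d} → a ≢ b → c + c ≤ a + b → d + d ≤ b + c → c ⊔ d < a ⊔ b
⊔-decreases-by-halving {a} {b} {c} {d} a≢b c+c≤a+b d+d≤b+c = ⊔-lub c<a⊔b d<a⊔b
  where
  c<a⊔b : c < a ⊔ b
  c<a⊔b = m+m<n+n⇒m<n (≤-<-trans c+c≤a+b (m≢n⇒m+n<[m⊔n]+[m⊔n] a≢b))
  d<a⊔b : d < a ⊔ b
  d<a⊔b = m+m<n+n⇒m<n (≤-<-trans d+d≤b+c (+-mono-≤-< (m≤n⊔m a b) c<a⊔b))

rough∧prime∣⇒≤ : ∀ {m s q} → m Rough s → Prime q → q ∣ s → m ≤ q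
rough∧prime∣⇒≤ r q-prime q∣s =
  ≮⇒≥ (λ q<m → r (hasNonTrivialDivisor {{prime⇒nonTrivial q-prime}} q<m q∣s))

-- Trial division upwards from m; k = s ∸ m is the remaining fuel.
smallestPrimeFactor-search : ∀ {s} k m → .{{NonTrivial m}} → k + m ≡ s → m Rough s →
                             ∃ λ p → SmallestPrimeFactor p s
smallestPrimeFactor-search {s} k m k+m≡s r with m ∣? s
... | yes m∣s = m , rough∧∣⇒prime r m∣s , m∣s , λ q q-prime q∣s → rough∧prime∣⇒≤ r q-prime q∣s
smallestPrimeFactor-search zero m m≡s r | no m∤s = ⊥-elim (m∤s (subst (m ∣_) m≡s ∣-refl))
smallestPrimeFactor-search (suc k) m k+m≡s r | no m∤s =
  smallestPrimeFactor-search k (suc m) {{n>1⇒nonTrivial (m<n⇒m<1+n (nonTrivial⇒n>1 m))}}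
    (trans (+-suc k m) k+m≡s) (∤⇒rough-suc m∤s r)

smallestPrimeFactor-exists : ∀ s → 2 ≤ s → ∃ λ p → SmallestPrimeFactor p s
smallestPrimeFactor-exists s 2≤s = smallestPrimeFactor-search (s ∸ 2) 2 (m∸n+n≡m 2≤s) 2-rough

common-divisor⇒¬prime[m+n] : ∀ {d m n} → 2 ≤ d → 0 < m → 0 < n → d ∣ m → d ∣ n → ¬ Prime (m + n)
common-divisor⇒¬prime[m+n] {d} {m} {n} 2≤d 0<m 0<n d∣m d∣n m+n-prime =
  Prime.notComposite m+n-prime (hasNonTrivialDivisor {{n>1⇒nonTrivial 2≤d}} d<m+n (∣m∣n⇒∣m+n d∣m d∣n))
  where
  d<m+n : d < m + n
  d<m+n = <-≤-trans (m<m+n d 0<n) (+-monoˡ-≤ n (∣⇒≤ {{>-nonZero 0<m}} d∣m))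

subprimeStep-∣ : ∀ {s u} → 2 ≤ s → SubprimeStep s u → u ∣ s
subprimeStep-∣ {s} 2≤s (prime-case , composite-case) with prime? s
... | yes s-prime = subst (_∣ s) (sym (prime-case s-prime)) ∣-refl
... | no s-composite with smallestPrimeFactor-exists s 2≤s
... | p , p-spf = divides p (sym (composite-case s-composite p p-spf))

subprimeStep-halves : ∀ {s u} → 2 ≤ s → ¬ Prime s → SubprimeStep s u → u + u ≤ s
subprimeStep-halves {s} {u} 2≤s s-composite (_ , composite-case)
  with smallestPrimeFactor-exists s 2≤s
... | p , p-spf@(p-prime , _) = begin
  u + u  ≡⟨ m+m≡2*m u ⟩
  2 * u  ≤⟨ *-monoˡ-≤ u (nonTrivial⇒n>1 p {{prime⇒nonTrivial p-prime}}) ⟩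
  p * u  ≡⟨ composite-case s-composite p p-spf ⟩
  s      ∎
  where open ≤-Reasoning

subprimeStep-double : ∀ {a u} → 2 ≤ a → SubprimeStep (a + a) u → u ≡ a
subprimeStep-double {a} {u} 2≤a (_ , composite-case) =
  *-cancelˡ-≡ u a 2 (trans (composite-case a+a-composite 2 two-spf) (m+m≡2*m a))
  where
  0<a : 0 < a
  0<a = <-trans z<s 2≤a
  a+a-composite : ¬ Prime (a + a)
  a+a-composite = common-divisor⇒¬prime[m+n] 2≤a 0<a 0<a ∣-refl ∣-refl
  two-spf : SmallestPrimeFactor 2 (a + a)
  two-spf = prime[2] , divides a (trans (m+m≡2*m a) (*-comm 2 a))
          , λ q q-prime _ → nonTrivial⇒n>1 q {{prime⇒nonTrivial q-prime}}

module SubprimeFibonacci {t : ℕ → ℕ} (t-subprime : IsSubprimeFib t) where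

  private
    positive : ∀ n → 0 < t n
    positive = proj₁ t-subprime
    step : ∀ n → SubprimeStep (t n + t (suc n)) (t (suc (suc n)))
    step = proj₂ t-subprime

  gcdAt : ℕ → ℕ
  gcdAt n = gcd (t n) (t (suc n))

  2≤sum : ∀ n → 2 ≤ t n + t (suc n)
  2≤sum n = +-mono-≤ (positive n) (positive (suc n))

  gcdAt[1+n]∣gcdAt[n] : ∀ n → gcdAt (suc n) ∣ gcdAt n
  gcdAt[1+n]∣gcdAt[n] n = gcd-greatest d∣t[n] d∣t[1+n]
    where
    d∣t[1+n] : gcdAt (suc n) ∣ t (suc n)
    d∣t[1+n] = gcd[m,n]∣m (t (suc n)) (t (suc (suc n)))
    d∣sum : gcdAt (suc n) ∣ t (suc n) + t n
    d∣sum = subst (gcdAt (suc n) ∣_) (+-comm (t n) _)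
              (∣-trans (gcd[m,n]∣n (t (suc n)) (t (suc (suc n))))
                       (subprimeStep-∣ (2≤sum n) (step n)))
    d∣t[n] : gcdAt (suc n) ∣ t n
    d∣t[n] = ∣m+n∣m⇒∣n d∣sum d∣t[1+n]

  gcdAt-antitone : ∀ {m n} → m ≤′ n → gcdAt n ∣ gcdAt m
  gcdAt-antitone ≤′-refl = ∣-refl
  gcdAt-antitone (≤′-step {n} m≤′n) = ∣-trans (gcdAt[1+n]∣gcdAt[n] n) (gcdAt-antitone m≤′n)

  gcdAt≢1⇒2≤gcdAt : ∀ n → gcdAt n ≢ 1 → 2 ≤ gcdAt n
  gcdAt≢1⇒2≤gcdAt n gcdAt≢1 =
    ≤∧≢⇒< (n≢0⇒n>0 (gcd[m,n]≢0 _ _ (inj₁ (n>0⇒n≢0 (positive n))))) (gcdAt≢1 ∘ sym)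

  gcdAt≢1⇒halves : ∀ n → gcdAt n ≢ 1 → t (suc (suc n)) + t (suc (suc n)) ≤ t n + t (suc n)
  gcdAt≢1⇒halves n gcdAt≢1 = subprimeStep-halves (2≤sum n) sum-composite (step n)
    where
    sum-composite : ¬ Prime (t n + t (suc n))
    sum-composite = common-divisor⇒¬prime[m+n] (gcdAt≢1⇒2≤gcdAt n gcdAt≢1)
      (positive n) (positive (suc n)) (gcd[m,n]∣m (t n) (t (suc n))) (gcd[m,n]∣n (t n) (t (suc n)))

  repeated-term⇒constant : ∀ {n} → 2 ≤ t n → t n ≡ t (suc n) →
                           ∀ k → t (k + n) ≡ t n × t (suc k + n) ≡ t n
  repeated-term⇒constant _ t[n]≡t[1+n] zero = refl , sym t[n]≡t[1+n]
  repeated-term⇒constant {n} 2≤t[n] t[n]≡t[1+n] (suc k)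
    with repeated-term⇒constant 2≤t[n] t[n]≡t[1+n] k
  ... | t[k+n]≡t[n] , t[1+k+n]≡t[n] = t[1+k+n]≡t[n] , trans t[2+k+n]≡t[k+n] t[k+n]≡t[n]
    where
    t[2+k+n]≡t[k+n] : t (suc (suc k + n)) ≡ t (k + n)
    t[2+k+n]≡t[k+n] = subprimeStep-double (subst (2 ≤_) (sym t[k+n]≡t[n]) 2≤t[n])
      (subst (λ x → SubprimeStep (t (k + n) + x) (t (suc (suc k + n))))
             (trans t[1+k+n]≡t[n] (sym t[k+n]≡t[n])) (step (k + n)))

  repeated-term⇒trivial : ∀ {n} → 2 ≤ t n → t n ≡ t (suc n) → Trivial t
  repeated-term⇒trivial {n} 2≤t[n] t[n]≡t[1+n] = n , λ m n≤m →
    subst (λ x → t x ≡ t n) (m∸n+n≡m n≤m) (proj₁ (repeated-term⇒constant 2≤t[n] t[n]≡t[1+n] (m ∸ n)))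

  -- Descent on max (t n) (t (suc n)); k bounds it from above and serves as fuel.
  nontrivial⇒coprime-somewhere : ¬ Trivial t → ∀ k n → t n ⊔ t (suc n) < k → ∃ λ m → gcdAt m ≡ 1
  nontrivial⇒coprime-somewhere nontrivial (suc k) n max<1+k
    with gcdAt n ≟ 1 | gcdAt (suc n) ≟ 1 | t n ≟ t (suc n)
  ... | yes gcdAt≡1 | _ | _ = n , gcdAt≡1
  ... | no _ | yes gcdAt≡1 | _ = suc n , gcdAt≡1
  ... | no gcdAt≢1 | no _ | yes t[n]≡t[1+n] =
    ⊥-elim (nontrivial (repeated-term⇒trivial 2≤t[n] t[n]≡t[1+n]))
    where
    2≤t[n] : 2 ≤ t n
    2≤t[n] = ≤-trans (gcdAt≢1⇒2≤gcdAt n gcdAt≢1) (∣⇒≤ {{>-nonZero (positive n)}} (gcd[m,n]∣m _ _))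
  ... | no gcdAt≢1 | no gcdAt'≢1 | no t[n]≢t[1+n] =
    nontrivial⇒coprime-somewhere nontrivial k (suc (suc n)) (<-≤-trans max-decreases (≤-pred max<1+k))
    where
    max-decreases : t (suc (suc n)) ⊔ t (suc (suc (suc n))) < t n ⊔ t (suc n)
    max-decreases = ⊔-decreases-by-halving t[n]≢t[1+n]
      (gcdAt≢1⇒halves n gcdAt≢1) (gcdAt≢1⇒halves (suc n) gcdAt'≢1)

open SubprimeFibonacci using (gcdAt-antitone; nontrivial⇒coprime-somewhere)

proposition2 : (t : ℕ → ℕ) → IsSubprimeFib t → ¬ Trivial t →
    ∃ λ N → ∀ n → N ≤ n → gcd (t n) (t (suc n)) ≡ 1
proposition2 t t-subprime nontrivial
  with nontrivial⇒coprime-somewhere t-subprime nontrivial _ 0 ≤-refl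
... | N , coprime[N] = N , λ n N≤n →
  ∣1⇒≡1 (subst (gcd (t n) (t (suc n)) ∣_) coprime[N] (gcdAt-antitone t-subprime (≤⇒≤′ N≤n)))
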